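{- Let $n,m$ be positive integers. The chain graph on $n$ vertices with binary string $0\,1^{m}0^{m}1^{n-2m-1}$ is Seidel integral (all eigenvalues of its Seidel matrix are integers) if $(n,m)$ takes one of the following values, where $r$ is a positive integer: (i) $(n,m)=(3r,r)$ with $r\ge 2$; (ii) $(n,m)=(13r,6r)$ or $(n,m)=(13r,2r)$ with $r\ge 2$; (iii) $(n,m)=(2r^2+2r+2,\ r^2+r)$ with $r\ge 1$; (iv) $(n,m)=(4r^2-2r+1,\ r)$ with $r\ge 3$; (v) $(n,m)=(4r^2+4r+4,\ 2r^2+2r)$ with $r\ge 1$.
   Context: For a binary string $b=0^{s_1}1^{t_1}\cdots 0^{s_k}1^{t_k}$ with all $s_i,t_i\ge 1$ ($x^p$ denotes the symbol $x$ repeated $p$ times), the chain graph with binary string $b$ is the graph obtained by reading $b$ left to right and adding one vertex per symbol: a $0$-vertex is added with no edges, and a $1$-vertex is added adjacent to all previously added $0$-vertices and to nothing else. For a graph with adjacency matrix $A$ of order $n$, its Seidel matrix is $S=J-I-2A$, where $J$ is the all-ones matrix and $I$ the identity. -}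

module Defs where

open import Data.Bool using (Bool; true; false; if_then_else_; _∧_; _∨_; not)
open import Data.Nat as ℕ using (ℕ; zero; suc; _∸_)
open import Data.Fin as Fin using (Fin; zero; suc; toℕ; punchIn)
open import Data.Fin.Properties using () renaming (_≟_ to _≟ᶠ_)
open import Data.Integer as ℤ using (ℤ; +_; _-_; _*_; -_; 1ℤ; 0ℤ; -1ℤ)
open import Data.List using (List; []; _∷_; length; replicate; _++_; lookup)
open import Data.Vec using (Vec)
import Data.Vec as V
open import Data.Product using (∃)
open import Relation.Binary.PropositionalEquality using (_≡_)
open import Relation.Nullary.Decidable using (⌊_⌋)

-- Bits of a binary string: false = symbol 0, true = symbol 1.

Mat : ℕ → Set
Mat n = Fin n → Fin n → ℤ

sumFin : ∀ {n} → (Fin n → ℤ) → ℤ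
sumFin {zero}  f = 0ℤ
sumFin {suc n} f = f zero ℤ.+ sumFin (λ i → f (suc i))

prodFin : ∀ {n} → (Fin n → ℤ) → ℤ
prodFin {zero}  f = 1ℤ
prodFin {suc n} f = f zero * prodFin (λ i → f (suc i))

sign : ℕ → ℤ
sign zero = 1ℤ
sign (suc k) = - sign k

det : ∀ {n} → Mat n → ℤ
det {zero}  M = 1ℤ
det {suc n} M = sumFin λ j → sign (toℕ j) * M zero j * det (λ i k → M (suc i) (punchIn j k))

-- Chain graph with binary string b: vertices are the positions of b.
-- Vertex i < j are adjacent iff b_i = 0 and b_j = 1 (a 1-vertex is joined
-- to all previously added 0-vertices), symmetrically.
chainAdj : (b : List Bool) → Fin (length b) → Fin (length b) → Bool
chainAdj b i j =
  (⌊ toℕ i ℕ.<? toℕ j ⌋ ∧ not (lookup b i) ∧ lookup b j)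
  ∨ (⌊ toℕ j ℕ.<? toℕ i ⌋ ∧ not (lookup b j) ∧ lookup b i)

-- Seidel matrix S = J - I - 2A.
seidel : (b : List Bool) → Mat (length b)
seidel b i j =
  if ⌊ i ≟ᶠ j ⌋ then 0ℤ else (if chainAdj b i j then -1ℤ else 1ℤ)

charPolyAt : ∀ {n} → Mat n → ℤ → ℤ
charPolyAt M x = det (λ i j → (if ⌊ i ≟ᶠ j ⌋ then x else 0ℤ) - M i j)

-- All eigenvalues (roots of the characteristic polynomial, with multiplicity)
-- are integers: the characteristic polynomial factors as ∏ (x - λᵢ) with λᵢ ∈ ℤ.
-- (Two integer polynomials are equal iff they agree at every integer.)
IntegralSpectrum : ∀ {n} → Mat n → Set
IntegralSpectrum {n} M =
  ∃ λ (ev : Vec ℤ n) → ∀ (x : ℤ) → charPolyAt M x ≡ prodFin (λ i → x - V.lookup ev i)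

SeidelIntegral : List Bool → Set
SeidelIntegral b = IntegralSpectrum (seidel b)

str : ℕ → ℕ → List Bool
str n m = false ∷ replicate m true ++ replicate m false ++ replicate (n ∸ (m ℕ.+ m) ∸ 1) true

data Family : ℕ → ℕ → Set where
  fam1  : ∀ r → 2 ℕ.≤ r → Family (3 ℕ.* r) r
  fam2a : ∀ r → 2 ℕ.≤ r → Family (13 ℕ.* r) (6 ℕ.* r)
  fam2b : ∀ r → 2 ℕ.≤ r → Family (13 ℕ.* r) (2 ℕ.* r)
  fam3  : ∀ r → 1 ℕ.≤ r → Family (2 ℕ.* r ℕ.* r ℕ.+ 2 ℕ.* r ℕ.+ 2) (r ℕ.* r ℕ.+ r)
  fam4  : ∀ r → 3 ℕ.≤ r → Family (4 ℕ.* r ℕ.* r ∸ 2 ℕ.* r ℕ.+ 1) r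
  fam5  : ∀ r → 1 ℕ.≤ r → Family (4 ℕ.* r ℕ.* r ℕ.+ 4 ℕ.* r ℕ.+ 4) (2 ℕ.* r ℕ.* r ℕ.+ 2 ℕ.* r)

-- Write t = x + 1. Grouping the vertices of a chain graph by runs, xI − S becomes tI + DG, where D is the
-- diagonal of weights (all 1 at first) and G i j = ±1 is the Seidel sign between the runs of i and j
-- (−1 on the diagonal). Two rows whose labels have equal, or exactly opposite, rows and columns of G are
-- twins: one column and one row operation merge them into a single row of summed weight, at the cost of a
-- factor t. Collapsing the runs of 0 1ᵐ 0ᵐ 1ᵏ this way, and then merging the first vertex with the last
-- run (their neighbourhoods are complementary), leaves a 3 × 3 determinant:
--   det (xI − S) = t ^ (n − 3) · (t³ − n t² + 4 (n − 2m) m²).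
-- In each family the cubic factor has three integer roots, exhibited through Vieta's formulas.
module Submission where

open import Defs
open import Data.Bool using (Bool; true; false; if_then_else_; not; _∧_)
open import Data.Bool.Properties using (∨-identityʳ; ∧-inverseˡ)
open import Data.Empty using (⊥-elim)
open import Data.Fin using (Fin; zero; suc; toℕ; fromℕ; punchIn; cast; #_)
open import Data.Fin.Properties
  using (_≟_; suc-injective; toℕ-injective; toℕ-cast; cast-is-id; punchIn-injective; punchInᵢ≢i)
open import Data.Integer as ℤ using (ℤ; +_; _+_; _-_; _*_; -_; _^_; 0ℤ; 1ℤ; -1ℤ)
import Data.Integer.Properties as ℤ
open import Algebra.Properties.Semiring.Sum ℤ.+-*-semiring
  using (sum-syntax; ∑-distrib-+; ∑-comm; *-distribˡ-sum; sum-cong-≗; sum-replicate-zero)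
  renaming (sum to ∑)
open import Data.Integer.Tactic.RingSolver using (solve-∀)
open import Data.List using (List; []; _∷_; _++_; length; lookup; replicate; map)
open import Data.List.Membership.Propositional.Properties using (∈-lookup)
open import Data.List.Properties using (++-assoc; ++-identityʳ; length-++-sucʳ)
open import Data.List.Relation.Unary.All as All using (All)
open import Data.Nat as ℕ using (ℕ; zero; suc; _≤_; _⊓_; _⊔_; _∸_; z≤n; s≤s; _<?_)
open import Data.Nat.ListAction using (sum)
import Data.Nat.Properties as ℕ
import Data.Nat.Tactic.RingSolver as ℕ-Solver
open import Data.Product using (_×_; _,_; proj₁; proj₂)
open import Data.Vec as V using (Vec)
open import Data.Vec.Functional using (updateAt)
open import Function using (_∘_; const)
open import Function.Definitions using (Injective)
open import Relation.Binary.PropositionalEquality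
open import Relation.Nullary.Decidable using (⌊_⌋; yes; no)

private
  variable
    n : ℕ
    L : Set

-- Determinants

sumFin≡∑ : (f : Fin n → ℤ) → sumFin f ≡ ∑ f
sumFin≡∑ {zero}  f = refl
sumFin≡∑ {suc n} f = cong (λ s → f zero + s) (sumFin≡∑ (f ∘ suc))

∑-zero : {f : Fin n → ℤ} → (∀ i → f i ≡ 0ℤ) → ∑ f ≡ 0ℤ
∑-zero {n} f≗0 = trans (sum-cong-≗ f≗0) (sum-replicate-zero n)

∑-*-∑-comm : ∀ {m} (a : Fin m → ℤ) (f : Fin m → Fin n → ℤ) (b : Fin n → ℤ) (g : Fin n → Fin m → ℤ) →
             (∀ i j → a i * f i j ≡ b j * g j i) →
             ∑[ i < m ] (a i * ∑ (f i)) ≡ ∑[ j < n ] (b j * ∑ (g j))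
∑-*-∑-comm a f b g eq = begin
  ∑[ i < _ ] (a i * ∑ (f i))           ≡⟨ sum-cong-≗ (λ i → *-distribˡ-sum (a i) (f i)) ⟩
  ∑[ i < _ ] ∑[ j < _ ] (a i * f i j)  ≡⟨ ∑-comm (λ i j → a i * f i j) ⟩
  ∑[ j < _ ] ∑[ i < _ ] (a i * f i j)  ≡⟨ sum-cong-≗ (λ j → sum-cong-≗ (λ i → eq i j)) ⟩
  ∑[ j < _ ] ∑[ i < _ ] (b j * g j i)  ≡⟨ sum-cong-≗ (λ j → *-distribˡ-sum (b j) (g j)) ⟨
  ∑[ j < _ ] (b j * ∑ (g j))           ∎
  where open ≡-Reasoning

_ᵀ : Mat n → Mat n
(M ᵀ) i j = M j i

_[_]≔_ : Mat n → Fin n → (Fin n → ℤ) → Mat n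
M [ i ]≔ r = updateAt M i (const r)

minor : Mat (suc n) → Fin (suc n) → Fin (suc n) → Mat n
minor M i j r k = M (punchIn i r) (punchIn j k)

rowTerm : Mat (suc n) → Fin (suc n) → ℤ
rowTerm M j = sign (toℕ j) * M zero j * det (minor M zero j)

columnTerm : Mat (suc n) → Fin (suc n) → ℤ
columnTerm M i = sign (toℕ i) * M i zero * det (minor M i zero)

det-expandRow : (M : Mat (suc n)) → det M ≡ ∑ (rowTerm M)
det-expandRow M = sumFin≡∑ (rowTerm M)

det-cong : {M N : Mat n} → (∀ i j → M i j ≡ N i j) → det M ≡ det N
det-cong {zero}  _   = refl
det-cong {suc n} {M} {N} M≗N = begin
  det M           ≡⟨ det-expandRow M ⟩
  ∑ (rowTerm M)   ≡⟨ sum-cong-≗ (λ j → cong₂ (λ a d → sign (toℕ j) * a * d) (M≗N zero j)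
                                                (det-cong (λ r k → M≗N (suc r) (punchIn j k)))) ⟩
  ∑ (rowTerm N)   ≡⟨ det-expandRow N ⟨
  det N           ∎
  where open ≡-Reasoning

private
  swap-signs : ∀ (s s′ a b d : ℤ) → (- s) * a * (s′ * b * d) ≡ (- s′) * b * (s * a * d)
  swap-signs = solve-∀

det-expandCol : (M : Mat (suc n)) → det M ≡ ∑ (columnTerm M)
det-expandCol {zero}  M = det-expandRow M
det-expandCol {suc n} M = begin
  det M
    ≡⟨ det-expandRow M ⟩
  rowTerm M zero + ∑[ j < suc n ] (a j * det (minor M zero (suc j)))
    ≡⟨ cong (λ s → rowTerm M zero + s) (sum-cong-≗ λ j → cong (a j *_) (det-expandCol (minor M zero (suc j)))) ⟩
  rowTerm M zero + ∑[ j < suc n ] (a j * ∑ (columnTerm (minor M zero (suc j))))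
    ≡⟨ cong (λ s → rowTerm M zero + s)
            (∑-*-∑-comm a (λ j → columnTerm (minor M zero (suc j))) b (λ i → rowTerm (minor M (suc i) zero))
                        (λ j i → swap-signs (sign (toℕ j)) (sign (toℕ i)) _ _ _)) ⟩
  columnTerm M zero + ∑[ i < suc n ] (b i * ∑ (rowTerm (minor M (suc i) zero)))
    ≡⟨ cong (λ s → columnTerm M zero + s) (sum-cong-≗ λ i → cong (b i *_) (det-expandRow (minor M (suc i) zero))) ⟨
  ∑ (columnTerm M)
    ∎
  where
  open ≡-Reasoning
  a b : Fin (suc n) → ℤ
  a j = sign (toℕ (suc j)) * M zero (suc j)
  b i = sign (toℕ (suc i)) * M (suc i) zero

det-transpose : (M : Mat n) → det (M ᵀ) ≡ det M
det-transpose {zero}  M = refl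
det-transpose {suc n} M = begin
  det (M ᵀ)         ≡⟨ det-expandRow (M ᵀ) ⟩
  ∑ (rowTerm (M ᵀ)) ≡⟨ sum-cong-≗ (λ i → cong (sign (toℕ i) * M i zero *_) (det-transpose (minor M i zero))) ⟩
  ∑ (columnTerm M)  ≡⟨ det-expandCol M ⟨
  det M             ∎
  where open ≡-Reasoning

private
  flip-sign : ∀ (s x d : ℤ) → s * x * d ≡ - ((- s) * x * d)
  flip-sign = solve-∀
  negated-sum : ∀ (a b c : ℤ) → - b + (- a + -1ℤ * c) ≡ - (a + (b + c))
  negated-sum = solve-∀
  by-minus-one : ∀ (s a d : ℤ) → s * a * (- d) ≡ -1ℤ * (s * a * d)
  by-minus-one = solve-∀

lowerColumnTerms : Mat (suc (suc n)) → ℤ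
lowerColumnTerms {n} M = ∑[ i < n ] columnTerm M (suc (suc i))

det-swap : (M N : Mat (suc (suc n))) →
           (∀ k → N zero k ≡ M (suc zero) k) → (∀ k → N (suc zero) k ≡ M zero k) →
           (∀ i k → N (suc (suc i)) k ≡ M (suc (suc i)) k) →
           det N ≡ - det M
lowerColumnTerms-swap : (M N : Mat (suc (suc n))) →
           (∀ k → N zero k ≡ M (suc zero) k) → (∀ k → N (suc zero) k ≡ M zero k) →
           (∀ i k → N (suc (suc i)) k ≡ M (suc (suc i)) k) →
           lowerColumnTerms N ≡ -1ℤ * lowerColumnTerms M

det-swap M N N₀ N₁ N₂ = begin
  det N
    ≡⟨ det-expandCol N ⟩
  columnTerm N zero + (columnTerm N (suc zero) + lowerColumnTerms N)
    ≡⟨ cong₂ _+_ first (cong₂ _+_ second (lowerColumnTerms-swap M N N₀ N₁ N₂)) ⟩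
  - columnTerm M (suc zero) + (- columnTerm M zero + -1ℤ * lowerColumnTerms M)
    ≡⟨ negated-sum (columnTerm M zero) (columnTerm M (suc zero)) (lowerColumnTerms M) ⟩
  - (columnTerm M zero + (columnTerm M (suc zero) + lowerColumnTerms M))
    ≡⟨ cong -_ (det-expandCol M) ⟨
  - det M
    ∎
  where
  open ≡-Reasoning
  minor₀ : ∀ r k → minor N zero zero r k ≡ minor M (suc zero) zero r k
  minor₀ zero    k = N₁ (suc k)
  minor₀ (suc r) k = N₂ r (suc k)
  minor₁ : ∀ r k → minor N (suc zero) zero r k ≡ minor M zero zero r k
  minor₁ zero    k = N₀ (suc k)
  minor₁ (suc r) k = N₂ r (suc k)
  first : columnTerm N zero ≡ - columnTerm M (suc zero)
  first = trans (cong₂ (λ x d → 1ℤ * x * d) (N₀ zero) (det-cong minor₀))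
                (flip-sign 1ℤ (M (suc zero) zero) (det (minor M (suc zero) zero)))
  second : columnTerm N (suc zero) ≡ - columnTerm M zero
  second = trans (cong₂ (λ x d → -1ℤ * x * d) (N₁ zero) (det-cong minor₁))
                 (flip-sign -1ℤ (M zero zero) (det (minor M zero zero)))

lowerColumnTerms-swap {zero}  M N N₀ N₁ N₂ = refl
lowerColumnTerms-swap {suc n} M N N₀ N₁ N₂ = begin
  ∑[ i < suc n ] columnTerm N (suc (suc i))
    ≡⟨ sum-cong-≗ (λ i → trans (cong₂ (λ x d → sign (toℕ (suc (suc i))) * x * d) (N₂ i zero) (swapped-minor i))
                                (by-minus-one (sign (toℕ (suc (suc i)))) (M (suc (suc i)) zero) _)) ⟩
  ∑[ i < suc n ] (-1ℤ * columnTerm M (suc (suc i)))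
    ≡⟨ *-distribˡ-sum -1ℤ (λ i → columnTerm M (suc (suc i))) ⟨
  -1ℤ * ∑[ i < suc n ] columnTerm M (suc (suc i))
    ∎
  where
  open ≡-Reasoning
  swapped-minor : ∀ i → det (minor N (suc (suc i)) zero) ≡ - det (minor M (suc (suc i)) zero)
  swapped-minor i = det-swap (minor M (suc (suc i)) zero) (minor N (suc (suc i)) zero)
                             (λ k → N₀ (suc k)) (λ k → N₁ (suc k)) (λ r k → N₂ (punchIn i r) (suc k))

private
  self-negating : ∀ x → x ≡ - x → x ≡ 0ℤ
  self-negating x x≡-x = ℤ.*-cancelˡ-≡ (+ 2) x 0ℤ (begin
    + 2 * x  ≡⟨ double x ⟩
    x + x    ≡⟨ cong (λ y → x + y) x≡-x ⟩
    x + - x  ≡⟨ ℤ.+-inverseʳ x ⟩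
    0ℤ       ∎)
    where
    open ≡-Reasoning
    double : ∀ x → + 2 * x ≡ x + x
    double = solve-∀

det-alternating : (M : Mat (suc (suc n))) → (∀ k → M zero k ≡ M (suc zero) k) → det M ≡ 0ℤ
det-alternating M M₀≡M₁ = self-negating (det M) (det-swap M M M₀≡M₁ (λ k → sym (M₀≡M₁ k)) (λ _ _ → refl))

private
  expand-row : ∀ (s u c v d : ℤ) → s * (u + c * v) * d ≡ s * u * d + c * (s * v * d)
  expand-row = solve-∀

det-linear₀ : (M U V : Mat (suc n)) (c : ℤ) →
              (∀ k → M zero k ≡ U zero k + c * V zero k) →
              (∀ i k → M (suc i) k ≡ U (suc i) k) → (∀ i k → M (suc i) k ≡ V (suc i) k) →
              det M ≡ det U + c * det V
det-linear₀ M U V c M₀ U₊ V₊ = begin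
  det M                                        ≡⟨ det-expandRow M ⟩
  ∑ (rowTerm M)                                ≡⟨ sum-cong-≗ split ⟩
  ∑[ j < _ ] (rowTerm U j + c * rowTerm V j)   ≡⟨ ∑-distrib-+ (rowTerm U) (λ j → c * rowTerm V j) ⟩
  ∑ (rowTerm U) + ∑[ j < _ ] (c * rowTerm V j) ≡⟨ cong (λ s → ∑ (rowTerm U) + s) (*-distribˡ-sum c (rowTerm V)) ⟨
  ∑ (rowTerm U) + c * ∑ (rowTerm V)            ≡⟨ cong₂ (λ x y → x + c * y) (det-expandRow U) (det-expandRow V) ⟨
  det U + c * det V                            ∎
  where
  open ≡-Reasoning
  split : ∀ j → rowTerm M j ≡ rowTerm U j + c * rowTerm V j
  split j = begin
    sign (toℕ j) * M zero j * det (minor M zero j)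
      ≡⟨ cong (λ x → sign (toℕ j) * x * det (minor M zero j)) (M₀ j) ⟩
    sign (toℕ j) * (U zero j + c * V zero j) * det (minor M zero j)
      ≡⟨ expand-row (sign (toℕ j)) (U zero j) c (V zero j) (det (minor M zero j)) ⟩
    sign (toℕ j) * U zero j * det (minor M zero j) + c * (sign (toℕ j) * V zero j * det (minor M zero j))
      ≡⟨ cong₂ (λ d d′ → sign (toℕ j) * U zero j * d + c * (sign (toℕ j) * V zero j * d′))
               (det-cong (λ r k → U₊ r (punchIn j k))) (det-cong (λ r k → V₊ r (punchIn j k))) ⟩
    rowTerm U j + c * rowTerm V j
      ∎

det-addRow₀ : (M N : Mat (suc (suc n))) (c : ℤ) →
              (∀ k → N zero k ≡ M zero k + c * M (suc zero) k) → (∀ i k → N (suc i) k ≡ M (suc i) k) →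
              det N ≡ det M
det-addRow₀ {n} M N c N₀ N₊ = begin
  det N              ≡⟨ det-linear₀ N M V c N₀ N₊ N₊ ⟩
  det M + c * det V  ≡⟨ cong (λ d → det M + c * d) (det-alternating V (λ _ → refl)) ⟩
  det M + c * 0ℤ     ≡⟨ cong (λ y → det M + y) (ℤ.*-zeroʳ c) ⟩
  det M + 0ℤ         ≡⟨ ℤ.+-identityʳ (det M) ⟩
  det M              ∎
  where
  open ≡-Reasoning
  V : Mat (suc (suc n))
  V = M [ zero ]≔ M (suc zero)

swap₀₁ : Mat (suc (suc n)) → Mat (suc (suc n))
swap₀₁ M zero          = M (suc zero)
swap₀₁ M (suc zero)    = M zero
swap₀₁ M (suc (suc i)) = M (suc (suc i))

det-addRow₁ : (M N : Mat (suc (suc n))) (c : ℤ) →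
              (∀ k → N zero k ≡ M zero k) → (∀ k → N (suc zero) k ≡ M (suc zero) k + c * M zero k) →
              (∀ i k → N (suc (suc i)) k ≡ M (suc (suc i)) k) →
              det N ≡ det M
det-addRow₁ M N c N₀ N₁ N₂ = begin
  det N             ≡⟨ ℤ.neg-involutive (det N) ⟨
  - - det N         ≡⟨ cong -_ (det-swap N (swap₀₁ N) (λ _ → refl) (λ _ → refl) (λ _ _ → refl)) ⟨
  - det (swap₀₁ N)  ≡⟨ cong -_ (det-addRow₀ (swap₀₁ M) (swap₀₁ N) c N₁ lower-rows) ⟩
  - det (swap₀₁ M)  ≡⟨ cong -_ (det-swap M (swap₀₁ M) (λ _ → refl) (λ _ → refl) (λ _ _ → refl)) ⟩
  - - det M         ≡⟨ ℤ.neg-involutive (det M) ⟩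
  det M             ∎
  where
  open ≡-Reasoning
  lower-rows : ∀ i k → swap₀₁ N (suc i) k ≡ swap₀₁ M (suc i) k
  lower-rows zero    k = N₀ k
  lower-rows (suc i) k = N₂ i k

private
  zero-entry : ∀ (s d : ℤ) → s * 0ℤ * d ≡ 0ℤ
  zero-entry = solve-∀
  leading-term : ∀ (a d : ℤ) → 1ℤ * a * d + 0ℤ ≡ a * d
  leading-term = solve-∀

det-zeroColumn : (M : Mat (suc n)) → (∀ i → M (suc i) zero ≡ 0ℤ) → det M ≡ M zero zero * det (minor M zero zero)
det-zeroColumn M M₊₀ = begin
  det M                                                ≡⟨ det-expandCol M ⟩
  columnTerm M zero + ∑[ i < _ ] columnTerm M (suc i)  ≡⟨ cong (λ s → columnTerm M zero + s) (∑-zero vanishing) ⟩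
  columnTerm M zero + 0ℤ                               ≡⟨ leading-term (M zero zero) (det (minor M zero zero)) ⟩
  M zero zero * det (minor M zero zero)                ∎
  where
  open ≡-Reasoning
  vanishing : ∀ i → columnTerm M (suc i) ≡ 0ℤ
  vanishing i = trans (cong (λ x → sign (toℕ (suc i)) * x * det (minor M (suc i) zero)) (M₊₀ i))
                      (zero-entry (sign (toℕ (suc i))) (det (minor M (suc i) zero)))

toFront : Fin (suc n) → Fin (suc n) → Fin (suc n)
toFront p zero    = p
toFront p (suc r) = punchIn p r

toFront-injective : (p : Fin (suc n)) → Injective _≡_ _≡_ (toFront p)
toFront-injective p {zero}  {zero}  _    = refl
toFront-injective p {zero}  {suc s} p≡ps = ⊥-elim (punchInᵢ≢i p s (sym p≡ps))
toFront-injective p {suc r} {zero}  pr≡p = ⊥-elim (punchInᵢ≢i p r pr≡p)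
toFront-injective p {suc r} {suc s} eq   = cong suc (punchIn-injective p r s eq)

private
  pull-sign : ∀ (s a p d : ℤ) → s * a * (p * d) ≡ p * (s * a * d)
  pull-sign = solve-∀

det-toFrontRows : (p : Fin (suc n)) (M : Mat (suc n)) → det (M ∘ toFront p) ≡ sign (toℕ p) * det M
det-toFrontRows zero M = trans (det-cong unmoved) (sym (ℤ.*-identityˡ (det M)))
  where
  unmoved : ∀ i j → M (toFront zero i) j ≡ M i j
  unmoved zero    j = refl
  unmoved (suc i) j = refl
det-toFrontRows {suc n} (suc p) M = begin
  det (M ∘ toFront (suc p))  ≡⟨ det-swap A (M ∘ toFront (suc p)) (λ _ → refl) (λ _ → refl) (λ _ _ → refl) ⟩
  - det A                    ≡⟨ cong -_ det-A ⟩
  - (sign (toℕ p) * det M)   ≡⟨ ℤ.neg-distribˡ-* (sign (toℕ p)) (det M) ⟩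
  - sign (toℕ p) * det M     ∎
  where
  open ≡-Reasoning
  A : Mat (suc (suc n))
  A zero    = M zero
  A (suc i) = M (suc (toFront p i))
  det-A : det A ≡ sign (toℕ p) * det M
  det-A = begin
    det A                                    ≡⟨ det-expandRow A ⟩
    ∑ (rowTerm A)                            ≡⟨ sum-cong-≗ rotated-minor ⟩
    ∑[ j < _ ] (sign (toℕ p) * rowTerm M j)  ≡⟨ *-distribˡ-sum (sign (toℕ p)) (rowTerm M) ⟨
    sign (toℕ p) * ∑ (rowTerm M)             ≡⟨ cong (sign (toℕ p) *_) (det-expandRow M) ⟨
    sign (toℕ p) * det M                     ∎
    where
    rotated-minor : ∀ j → rowTerm A j ≡ sign (toℕ p) * rowTerm M j
    rotated-minor j = trans (cong (sign (toℕ j) * M zero j *_) (det-toFrontRows p (minor M zero j)))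
                            (pull-sign (sign (toℕ j)) (M zero j) (sign (toℕ p)) (det (minor M zero j)))

det-toFrontCols : (p : Fin (suc n)) (M : Mat (suc n)) → det (λ i j → M i (toFront p j)) ≡ sign (toℕ p) * det M
det-toFrontCols p M = begin
  det (((M ᵀ) ∘ toFront p) ᵀ)  ≡⟨ det-transpose ((M ᵀ) ∘ toFront p) ⟩
  det ((M ᵀ) ∘ toFront p)      ≡⟨ det-toFrontRows p (M ᵀ) ⟩
  sign (toℕ p) * det (M ᵀ)     ≡⟨ cong (sign (toℕ p) *_) (det-transpose M) ⟩
  sign (toℕ p) * det M         ∎
  where open ≡-Reasoning

private
  sign-squared : ∀ k → sign k * sign k ≡ 1ℤ
  sign-squared zero    = refl
  sign-squared (suc k) = trans (negated-square (sign k)) (sign-squared k)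
    where
    negated-square : ∀ s → (- s) * (- s) ≡ s * s
    negated-square = solve-∀

det-toFront : (p : Fin (suc n)) (M : Mat (suc n)) → det (λ i j → M (toFront p i) (toFront p j)) ≡ det M
det-toFront p M = begin
  det (λ i j → M (toFront p i) (toFront p j))     ≡⟨ det-toFrontRows p (λ i j → M i (toFront p j)) ⟩
  sign (toℕ p) * det (λ i j → M i (toFront p j))  ≡⟨ cong (sign (toℕ p) *_) (det-toFrontCols p M) ⟩
  sign (toℕ p) * (sign (toℕ p) * det M)           ≡⟨ ℤ.*-assoc (sign (toℕ p)) (sign (toℕ p)) (det M) ⟨
  sign (toℕ p) * sign (toℕ p) * det M             ≡⟨ cong (_* det M) (sign-squared (toℕ p)) ⟩
  1ℤ * det M                                      ≡⟨ ℤ.*-identityˡ (det M) ⟩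
  det M                                           ∎
  where open ≡-Reasoning

det-cast : ∀ {m} (eq : m ≡ n) (M : Mat n) → det (λ i j → M (cast eq i) (cast eq j)) ≡ det M
det-cast refl M = det-cong (λ i j → cong₂ M (cast-is-id refl i) (cast-is-id refl j))

private
  -- The left-hand side is what det unfolds to on a 3 × 3 matrix with these entries.
  laplace₃ : ∀ (a b c d e f g h i : ℤ) →
    1ℤ * a * (1ℤ * e * (1ℤ * i * 1ℤ + 0ℤ) + (-1ℤ * f * (1ℤ * h * 1ℤ + 0ℤ) + 0ℤ))
      + (-1ℤ * b * (1ℤ * d * (1ℤ * i * 1ℤ + 0ℤ) + (-1ℤ * f * (1ℤ * g * 1ℤ + 0ℤ) + 0ℤ))
      + (1ℤ * c * (1ℤ * d * (1ℤ * h * 1ℤ + 0ℤ) + (-1ℤ * e * (1ℤ * g * 1ℤ + 0ℤ) + 0ℤ)) + 0ℤ))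
    ≡ a * (e * i - f * h) - b * (d * i - f * g) + c * (d * h - e * g)
  laplace₃ = solve-∀

det-3×3 : (M : Mat 3) →
          det M ≡ M (# 0) (# 0) * (M (# 1) (# 1) * M (# 2) (# 2) - M (# 1) (# 2) * M (# 2) (# 1))
                - M (# 0) (# 1) * (M (# 1) (# 0) * M (# 2) (# 2) - M (# 1) (# 2) * M (# 2) (# 0))
                + M (# 0) (# 2) * (M (# 1) (# 0) * M (# 2) (# 1) - M (# 1) (# 1) * M (# 2) (# 0))
det-3×3 M = laplace₃ (M (# 0) (# 0)) (M (# 0) (# 1)) (M (# 0) (# 2))
                     (M (# 1) (# 0)) (M (# 1) (# 1)) (M (# 1) (# 2))
                     (M (# 2) (# 0)) (M (# 2) (# 1)) (M (# 2) (# 2))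

-- Matrices tI + DG with rows indexed by labelled vertices

⌊≟⌋-injective : ∀ {m n} {σ : Fin m → Fin n} → Injective _≡_ _≡_ σ → ∀ i j → ⌊ σ i ≟ σ j ⌋ ≡ ⌊ i ≟ j ⌋
⌊≟⌋-injective {σ = σ} σ-inj i j with i ≟ j | σ i ≟ σ j
... | yes _   | yes _     = refl
... | no  _   | no  _     = refl
... | yes i≡j | no  σi≢σj = ⊥-elim (σi≢σj (cong σ i≡j))
... | no  i≢j | yes σi≡σj = ⊥-elim (i≢j (σ-inj σi≡σj))

cast-injective : ∀ {m n} (eq : m ≡ n) → Injective _≡_ _≡_ (cast eq)
cast-injective eq {i} {j} castᵢ≡castⱼ = toℕ-injective (begin
  toℕ i            ≡⟨ toℕ-cast eq i ⟨
  toℕ (cast eq i)  ≡⟨ cong toℕ castᵢ≡castⱼ ⟩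
  toℕ (cast eq j)  ≡⟨ toℕ-cast eq j ⟩
  toℕ j            ∎)
  where open ≡-Reasoning

classMatrix : (L → L → ℤ) → ℤ → (xs : List (L × ℤ)) → Mat (length xs)
classMatrix g t xs i j =
  (if ⌊ i ≟ j ⌋ then t else 0ℤ) + proj₂ (lookup xs i) * g (proj₁ (lookup xs i)) (proj₁ (lookup xs j))

classMatrix-cong : (g : L → L → ℤ) (t : ℤ) (xs ys : List (L × ℤ))
                   {i j : Fin (length xs)} {i′ j′ : Fin (length ys)} →
                   ⌊ i ≟ j ⌋ ≡ ⌊ i′ ≟ j′ ⌋ → lookup xs i ≡ lookup ys i′ → lookup xs j ≡ lookup ys j′ →
                   classMatrix g t xs i j ≡ classMatrix g t ys i′ j′
classMatrix-cong g t xs ys δ≡ xᵢ≡ xⱼ≡ rewrite δ≡ | xᵢ≡ | xⱼ≡ = refl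

classMatrix-suc : (g : L → L → ℤ) (t : ℤ) (x : L × ℤ) (xs : List (L × ℤ)) (i j : Fin (length xs)) →
                  classMatrix g t (x ∷ xs) (suc i) (suc j) ≡ classMatrix g t xs i j
classMatrix-suc g t x xs i j = classMatrix-cong g t (x ∷ xs) xs (⌊≟⌋-injective suc-injective i j) refl refl

Twins : (L → L → ℤ) → ℤ → L → L → L → Set
Twins g ε a b c = g b c ≡ ε * g a c × g c a ≡ ε * g c b

private
  corner-identity : ∀ t u ε G → t + u * (ε * G) + - ε * (0ℤ + u * G) ≡ t
  corner-identity = solve-∀
  second-row-identity : ∀ t u w ε G G′ →
    0ℤ + w * (ε * G′) + - ε * (t + w * G′) + ε * (t + u * (ε * G) + - ε * (0ℤ + u * G)) ≡ 0ℤ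
  second-row-identity = solve-∀
  lower-row-identity : ∀ v ε G → 0ℤ + v * (ε * G) + - ε * (0ℤ + v * G) ≡ 0ℤ
  lower-row-identity = solve-∀
  merged-row-identity : ∀ δ u w ε G → δ + w * (ε * G) + ε * (0ℤ + u * G) ≡ δ + (u + w) * (ε * G)
  merged-row-identity = solve-∀

-- Subtracting ε · column 1 from column 0 leaves t (e₀ − ε e₁) there; adding ε · row 0 to row 1 then
-- clears column 0 below the corner t, and the minor of the corner is the merged matrix.
det-merge : (g : L → L → ℤ) (t ε : ℤ) (a b : L) (u w : ℤ) (xs : List (L × ℤ)) →
            All (Twins g ε a b ∘ proj₁) ((a , u) ∷ (b , w) ∷ xs) →
            det (classMatrix g t ((a , u) ∷ (b , w) ∷ xs)) ≡ t * det (classMatrix g t ((b , u + w) ∷ xs))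
det-merge {L} g t ε a b u w xs (twin-a All.∷ twin-b All.∷ twins) = begin
  det F                                  ≡⟨ det-transpose F ⟨
  det (F ᵀ)                              ≡⟨ det-addRow₀ (F ᵀ) G (- ε) (λ _ → refl) (λ _ _ → refl) ⟨
  det G                                  ≡⟨ det-transpose G ⟨
  det (G ᵀ)                              ≡⟨ det-addRow₁ (G ᵀ) H ε (λ _ → refl) (λ _ → refl) (λ _ _ → refl) ⟨
  det H                                  ≡⟨ det-zeroColumn H first-column ⟩
  H zero zero * det (minor H zero zero)  ≡⟨ cong₂ _*_ corner (det-cong merged) ⟩
  t * det F′                             ∎
  where
  open ≡-Reasoning
  F G H : Mat (suc (suc (length xs)))
  F = classMatrix g t ((a , u) ∷ (b , w) ∷ xs)
  G = (F ᵀ) [ zero ]≔ (λ k → F k zero + - ε * F k (suc zero))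
  H = (G ᵀ) [ suc zero ]≔ (λ k → G k (suc zero) + ε * G k zero)
  F′ : Mat (suc (length xs))
  F′ = classMatrix g t ((b , u + w) ∷ xs)
  label : Fin (length xs) → L
  label r = proj₁ (lookup xs r)
  weight : Fin (length xs) → ℤ
  weight r = proj₂ (lookup xs r)
  twin : ∀ r → Twins g ε a b (label r)
  twin r = All.lookup twins (∈-lookup r)

  corner : H zero zero ≡ t
  corner = trans (cong (λ z → t + u * z + - ε * (0ℤ + u * g a b)) (proj₂ twin-a)) (corner-identity t u ε (g a b))

  first-column : ∀ i → H (suc i) zero ≡ 0ℤ
  first-column zero = trans
    (cong₂ (λ z z′ → 0ℤ + w * z + - ε * (t + w * g b b) + ε * (t + u * z′ + - ε * (0ℤ + u * g a b)))
           (proj₂ twin-b) (proj₂ twin-a))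
    (second-row-identity t u w ε (g a b) (g b b))
  first-column (suc r) = trans
    (cong (λ z → 0ℤ + weight r * z + - ε * (0ℤ + weight r * g (label r) b)) (proj₂ (twin r)))
    (lower-row-identity (weight r) ε (g (label r) b))

  merged : ∀ r k → minor H zero zero r k ≡ F′ r k
  merged zero zero = trans
    (cong (λ z → t + w * z + ε * (0ℤ + u * g a b)) (proj₁ twin-b))
    (trans (merged-row-identity t u w ε (g a b)) (cong (λ z → t + (u + w) * z) (sym (proj₁ twin-b))))
  merged zero (suc k) = trans
    (cong (λ z → 0ℤ + w * z + ε * (0ℤ + u * g a (label k))) (proj₁ (twin k)))
    (trans (merged-row-identity 0ℤ u w ε (g a (label k))) (cong (λ z → 0ℤ + (u + w) * z) (sym (proj₁ (twin k)))))
  merged (suc r) zero    = refl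
  merged (suc r) (suc k) = begin
    F (suc (suc r)) (suc (suc k))                   ≡⟨ classMatrix-suc g t (a , u) ((b , w) ∷ xs) (suc r) (suc k) ⟩
    classMatrix g t ((b , w) ∷ xs) (suc r) (suc k)  ≡⟨ classMatrix-suc g t (b , w) xs r k ⟩
    classMatrix g t xs r k                          ≡⟨ classMatrix-suc g t (b , u + w) xs r k ⟨
    F′ (suc r) (suc k)                              ∎

private
  lookup-toFront-last : ∀ {X : Set} (x : X) (xs : List X) (eq : suc (length xs) ≡ length (xs ++ x ∷ [])) i →
                        lookup (xs ++ x ∷ []) (cast eq (toFront (fromℕ (length xs)) i)) ≡ lookup (x ∷ xs) i
  lookup-toFront-last x []       eq zero          = refl
  lookup-toFront-last x (y ∷ ys) eq zero          = lookup-toFront-last x ys (cong ℕ.pred eq) zero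
  lookup-toFront-last x (y ∷ ys) eq (suc zero)    = refl
  lookup-toFront-last x (y ∷ ys) eq (suc (suc r)) = lookup-toFront-last x ys (cong ℕ.pred eq) (suc r)

det-rotate : (g : L → L → ℤ) (t : ℤ) (x : L × ℤ) (xs : List (L × ℤ)) →
             det (classMatrix g t (x ∷ xs)) ≡ det (classMatrix g t (xs ++ x ∷ []))
det-rotate g t x xs = begin
  det (classMatrix g t (x ∷ xs))                     ≡⟨ det-cong rotated ⟩
  det (λ i j → C (toFront last i) (toFront last j))  ≡⟨ det-toFront last C ⟩
  det C                                              ≡⟨ det-cast eq (classMatrix g t (xs ++ x ∷ [])) ⟩
  det (classMatrix g t (xs ++ x ∷ []))               ∎
  where
  open ≡-Reasoning
  eq : suc (length xs) ≡ length (xs ++ x ∷ [])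
  eq = trans (cong (suc ∘ length) (sym (++-identityʳ xs))) (sym (length-++-sucʳ xs x []))
  last : Fin (suc (length xs))
  last = fromℕ (length xs)
  C : Mat (suc (length xs))
  C i j = classMatrix g t (xs ++ x ∷ []) (cast eq i) (cast eq j)
  rotated : ∀ i j → classMatrix g t (x ∷ xs) i j ≡ C (toFront last i) (toFront last j)
  rotated i j = classMatrix-cong g t (x ∷ xs) (xs ++ x ∷ [])
    (sym (⌊≟⌋-injective (toFront-injective last ∘ cast-injective eq) i j))
    (sym (lookup-toFront-last x xs eq i)) (sym (lookup-toFront-last x xs eq j))

det-collapse : (g : L → L → ℤ) (t : ℤ) (a : L) (u : ℤ) (s : ℕ) (ys : List (L × ℤ)) →
               det (classMatrix g t ((a , u) ∷ replicate s (a , 1ℤ) ++ ys))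
                 ≡ t ^ s * det (classMatrix g t ((a , u + + s) ∷ ys))
det-collapse g t a u zero ys = begin
  det (classMatrix g t ((a , u) ∷ ys))             ≡⟨ cong (λ u′ → det (classMatrix g t ((a , u′) ∷ ys))) (ℤ.+-identityʳ u) ⟨
  det (classMatrix g t ((a , u + + 0) ∷ ys))       ≡⟨ ℤ.*-identityˡ _ ⟨
  1ℤ * det (classMatrix g t ((a , u + + 0) ∷ ys))  ∎
  where open ≡-Reasoning
det-collapse g t a u (suc s) ys = begin
  det (classMatrix g t ((a , u) ∷ (a , 1ℤ) ∷ replicate s (a , 1ℤ) ++ ys))
    ≡⟨ det-merge g t 1ℤ a a u 1ℤ (replicate s (a , 1ℤ) ++ ys) (All.universal (λ y → self-twin (proj₁ y)) _) ⟩
  t * det (classMatrix g t ((a , u + 1ℤ) ∷ replicate s (a , 1ℤ) ++ ys))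
    ≡⟨ cong (t *_) (det-collapse g t a (u + 1ℤ) s ys) ⟩
  t * (t ^ s * det (classMatrix g t ((a , u + 1ℤ + + s) ∷ ys)))
    ≡⟨ cong (λ u′ → t * (t ^ s * det (classMatrix g t ((a , u′) ∷ ys)))) (ℤ.+-assoc u 1ℤ (+ s)) ⟩
  t * (t ^ s * det (classMatrix g t ((a , u + + suc s) ∷ ys)))
    ≡⟨ ℤ.*-assoc t (t ^ s) _ ⟨
  t ^ suc s * det (classMatrix g t ((a , u + + suc s) ∷ ys))
    ∎
  where
  open ≡-Reasoning
  self-twin : ∀ c → Twins g 1ℤ a a c
  self-twin c = sym (ℤ.*-identityˡ (g a c)) , sym (ℤ.*-identityˡ (g c a))

runs : {X : Set} → (ℕ → X) → List ℕ → List X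
runs f []       = []
runs f (s ∷ ss) = replicate s (f 0) ++ runs (f ∘ suc) ss

runWeights : (ℕ → L) → List ℕ → List (L × ℤ)
runWeights f []       = []
runWeights f (s ∷ ss) = (f 0 , + s) ∷ runWeights (f ∘ suc) ss

-- Each collapsed run is rotated behind acc, so that the next run comes to the front.
det-runs : (g : L → L → ℤ) (t : ℤ) (f : ℕ → L) (es : List ℕ) (acc : List (L × ℤ)) →
           det (classMatrix g t (runs (λ r → (f r , 1ℤ)) (map suc es) ++ acc))
             ≡ t ^ sum es * det (classMatrix g t (acc ++ runWeights f (map suc es)))
det-runs g t f [] acc = begin
  det (classMatrix g t acc)               ≡⟨ cong (det ∘ classMatrix g t) (++-identityʳ acc) ⟨
  det (classMatrix g t (acc ++ []))       ≡⟨ ℤ.*-identityˡ _ ⟨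
  1ℤ * det (classMatrix g t (acc ++ []))  ∎
  where open ≡-Reasoning
det-runs {L} g t f (e ∷ es) acc = begin
  det (F ((replicate (suc e) (f 0 , 1ℤ) ++ rest) ++ acc))
    ≡⟨ cong (det ∘ F) (++-assoc (replicate (suc e) (f 0 , 1ℤ)) rest acc) ⟩
  det (F ((f 0 , 1ℤ) ∷ replicate e (f 0 , 1ℤ) ++ rest ++ acc))
    ≡⟨ det-collapse g t (f 0) 1ℤ e (rest ++ acc) ⟩
  t ^ e * det (F (run ∷ rest ++ acc))
    ≡⟨ cong (t ^ e *_) (det-rotate g t run (rest ++ acc)) ⟩
  t ^ e * det (F ((rest ++ acc) ++ run ∷ []))
    ≡⟨ cong (λ l → t ^ e * det (F l)) (++-assoc rest acc (run ∷ [])) ⟩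
  t ^ e * det (F (rest ++ acc ++ run ∷ []))
    ≡⟨ cong (t ^ e *_) (det-runs g t (f ∘ suc) es (acc ++ run ∷ [])) ⟩
  t ^ e * (t ^ sum es * det (F ((acc ++ run ∷ []) ++ runWeights (f ∘ suc) (map suc es))))
    ≡⟨ cong (λ l → t ^ e * (t ^ sum es * det (F l))) (++-assoc acc (run ∷ []) _) ⟩
  t ^ e * (t ^ sum es * det (F (acc ++ runWeights f (map suc (e ∷ es)))))
    ≡⟨ ℤ.*-assoc (t ^ e) (t ^ sum es) _ ⟨
  t ^ e * t ^ sum es * det (F (acc ++ runWeights f (map suc (e ∷ es))))
    ≡⟨ cong (_* det (F (acc ++ runWeights f (map suc (e ∷ es))))) (ℤ.^-distribˡ-+-* t e (sum es)) ⟨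
  t ^ sum (e ∷ es) * det (F (acc ++ runWeights f (map suc (e ∷ es))))
    ∎
  where
  open ≡-Reasoning
  F : (xs : List (L × ℤ)) → Mat (length xs)
  F = classMatrix g t
  rest : List (L × ℤ)
  rest = runs (λ r → (f (suc r) , 1ℤ)) (map suc es)
  run : L × ℤ
  run = (f 0 , + suc e)

-- Chain graphs given by their runs

runBit : ℕ → Bool
runBit zero    = false
runBit (suc r) = not (runBit r)

runAdjacent : ℕ → ℕ → Bool
runAdjacent r r′ = not (runBit (r ⊓ r′)) ∧ runBit (r ⊔ r′)

runSign : ℕ → ℕ → ℤ
runSign r r′ = if runAdjacent r r′ then 1ℤ else -1ℤ

runAdjacent-≤ : ∀ {r r′} → r ≤ r′ → runAdjacent r r′ ≡ not (runBit r) ∧ runBit r′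
runAdjacent-≤ r≤r′ = cong₂ (λ a b → not (runBit a) ∧ runBit b) (ℕ.m≤n⇒m⊓n≡m r≤r′) (ℕ.m≤n⇒m⊔n≡n r≤r′)

runAdjacent-≥ : ∀ {r r′} → r′ ≤ r → runAdjacent r r′ ≡ not (runBit r′) ∧ runBit r
runAdjacent-≥ r′≤r = cong₂ (λ a b → not (runBit a) ∧ runBit b) (ℕ.m≥n⇒m⊓n≡n r′≤r) (ℕ.m≥n⇒m⊔n≡m r′≤r)

runSign-diagonal : ∀ r → runSign r r ≡ -1ℤ
runSign-diagonal r = cong (if_then 1ℤ else -1ℤ) (trans (runAdjacent-≤ {r} ℕ.≤-refl) (∧-inverseˡ (runBit r)))

runIndex : List ℕ → ℕ → ℕ
runIndex []           p       = 0
runIndex (zero  ∷ ss) p       = suc (runIndex ss p)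
runIndex (suc s ∷ ss) zero    = 0
runIndex (suc s ∷ ss) (suc p) = runIndex (s ∷ ss) p

runIndex-mono : ∀ ss {p q} → p ≤ q → runIndex ss p ≤ runIndex ss q
runIndex-mono []           _         = z≤n
runIndex-mono (zero  ∷ ss) p≤q       = s≤s (runIndex-mono ss p≤q)
runIndex-mono (suc s ∷ ss) z≤n       = z≤n
runIndex-mono (suc s ∷ ss) (s≤s p≤q) = runIndex-mono (s ∷ ss) p≤q

lookup-runs : ∀ {X : Set} (f : ℕ → X) ss (i : Fin (length (runs f ss))) →
              lookup (runs f ss) i ≡ f (runIndex ss (toℕ i))
lookup-runs f (zero  ∷ ss) i       = lookup-runs (f ∘ suc) ss i
lookup-runs f (suc s ∷ ss) zero    = refl
lookup-runs f (suc s ∷ ss) (suc i) = lookup-runs f (s ∷ ss) i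

length-runs : ∀ {X : Set} (f : ℕ → X) ss → length (runs f ss) ≡ sum ss
length-runs f []           = refl
length-runs f (zero  ∷ ss) = length-runs (f ∘ suc) ss
length-runs f (suc s ∷ ss) = cong suc (length-runs f (s ∷ ss))

chainAdj-runs : ∀ ss (i j : Fin (length (runs runBit ss))) → i ≢ j →
                chainAdj (runs runBit ss) i j ≡ runAdjacent (runIndex ss (toℕ i)) (runIndex ss (toℕ j))
chainAdj-runs ss i j i≢j
  rewrite lookup-runs runBit ss i | lookup-runs runBit ss j
  with toℕ i <? toℕ j | toℕ j <? toℕ i
... | yes i<j | yes j<i = ⊥-elim (ℕ.<-asym i<j j<i)
... | yes i<j | no  _   = trans (∨-identityʳ _) (sym (runAdjacent-≤ (runIndex-mono ss (ℕ.<⇒≤ i<j))))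
... | no  _   | yes j<i = sym (runAdjacent-≥ (runIndex-mono ss (ℕ.<⇒≤ j<i)))
... | no  i≮j | no  j≮i = ⊥-elim (i≢j (toℕ-injective (ℕ.≤-antisym (ℕ.≮⇒≥ j≮i) (ℕ.≮⇒≥ i≮j))))

private
  diagonal-entry : ∀ x → x - 0ℤ ≡ x + 1ℤ + 1ℤ * -1ℤ
  diagonal-entry = solve-∀
  off-diagonal-entry : ∀ a → 0ℤ - (if a then -1ℤ else 1ℤ) ≡ 0ℤ + 1ℤ * (if a then 1ℤ else -1ℤ)
  off-diagonal-entry true  = refl
  off-diagonal-entry false = refl

seidel-charPoly-runs : ∀ ss x →
  charPolyAt (seidel (runs runBit ss)) x ≡ det (classMatrix runSign (x + 1ℤ) (runs (λ r → (r , 1ℤ)) ss))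
seidel-charPoly-runs ss x = trans (det-cong entry) (det-cast eq (classMatrix runSign (x + 1ℤ) labelled))
  where
  b : List Bool
  b = runs runBit ss
  labelled : List (ℕ × ℤ)
  labelled = runs (λ r → (r , 1ℤ)) ss
  eq : length b ≡ length labelled
  eq = trans (length-runs runBit ss) (sym (length-runs (λ r → (r , 1ℤ)) ss))
  run : Fin (length b) → ℕ
  run i = runIndex ss (toℕ i)
  label-at : ∀ i → lookup labelled (cast eq i) ≡ (run i , 1ℤ)
  label-at i = trans (lookup-runs (λ r → (r , 1ℤ)) ss (cast eq i)) (cong (λ p → (runIndex ss p , 1ℤ)) (toℕ-cast eq i))
  seidel-entry : ∀ i j → (if ⌊ i ≟ j ⌋ then x else 0ℤ) - seidel b i j
                         ≡ (if ⌊ i ≟ j ⌋ then x + 1ℤ else 0ℤ) + 1ℤ * runSign (run i) (run j)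
  seidel-entry i j with i ≟ j
  ... | yes refl = trans (diagonal-entry x) (cong (λ s → x + 1ℤ + 1ℤ * s) (sym (runSign-diagonal (run i))))
  ... | no  i≢j  = trans (cong (λ a → 0ℤ - (if a then -1ℤ else 1ℤ)) (chainAdj-runs ss i j i≢j))
                         (off-diagonal-entry (runAdjacent (run i) (run j)))
  entry : ∀ i j → (if ⌊ i ≟ j ⌋ then x else 0ℤ) - seidel b i j
                  ≡ classMatrix runSign (x + 1ℤ) labelled (cast eq i) (cast eq j)
  entry i j rewrite ⌊≟⌋-injective (cast-injective eq) i j | label-at i | label-at j = seidel-entry i j

str-runs : ∀ m k → str (m ℕ.+ m ℕ.+ suc k) m ≡ runs runBit (1 ∷ m ∷ m ∷ k ∷ [])
str-runs m k = cong (λ l → false ∷ replicate m true ++ replicate m false ++ l)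
  (trans (cong (λ j → replicate (j ∸ 1) true) (ℕ.m+n∸m≡n (m ℕ.+ m) (suc k))) (sym (++-identityʳ _)))

-- With W = m and K = n − 2m this is y³ − n y² + 4 (n − 2m) m².
seidelCubic : ℤ → ℤ → ℤ → ℤ
seidelCubic W K y = y * y * y - (W + W + K) * (y * y) + + 4 * K * (W * W)

private
  sarrus-quotient : ∀ t W K →
    let a = t + K * -1ℤ ; b = 0ℤ + K * 1ℤ ; c = 0ℤ + K * -1ℤ
        d = 0ℤ + W * 1ℤ ; e = t + W * -1ℤ ; f = 0ℤ + W * -1ℤ
        g = 0ℤ + W * -1ℤ ; h = 0ℤ + W * -1ℤ ; i = t + W * -1ℤ
    in a * (e * i - f * h) - b * (d * i - f * g) + c * (d * h - e * g)
         ≡ t * t * t - (W + W + K) * (t * t) + + 4 * K * (W * W)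
  sarrus-quotient = solve-∀

det-quotient : ∀ t W K → det (classMatrix runSign t ((0 , K) ∷ (1 , W) ∷ (2 , W) ∷ [])) ≡ seidelCubic W K t
det-quotient t W K = trans (det-3×3 (classMatrix runSign t ((0 , K) ∷ (1 , W) ∷ (2 , W) ∷ []))) (sarrus-quotient t W K)

seidel-charPoly-str : ∀ m k x →
  charPolyAt (seidel (str (suc m ℕ.+ suc m ℕ.+ suc (suc k)) (suc m))) x
    ≡ (x + 1ℤ) ^ (m ℕ.+ m ℕ.+ k) * ((x + 1ℤ) * seidelCubic (+ suc m) (+ suc (suc k)) (x + 1ℤ))
seidel-charPoly-str m k x = begin
  charPolyAt (seidel (str (suc m ℕ.+ suc m ℕ.+ suc (suc k)) (suc m))) x
    ≡⟨ cong (λ b → charPolyAt (seidel b) x) (str-runs (suc m) (suc k)) ⟩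
  charPolyAt (seidel (runs runBit sizes)) x
    ≡⟨ seidel-charPoly-runs sizes x ⟩
  det (F (runs (λ r → (r , 1ℤ)) sizes))
    ≡⟨ cong (det ∘ F) (++-identityʳ (runs (λ r → (r , 1ℤ)) sizes)) ⟨
  det (F (runs (λ r → (r , 1ℤ)) sizes ++ []))
    ≡⟨ det-runs runSign t (λ r → r) (0 ∷ m ∷ m ∷ k ∷ []) [] ⟩
  t ^ e * det (F ((0 , 1ℤ) ∷ (1 , W) ∷ (2 , W) ∷ (3 , K) ∷ []))
    ≡⟨ cong (t ^ e *_) (det-rotate runSign t (3 , K) ((0 , 1ℤ) ∷ (1 , W) ∷ (2 , W) ∷ [])) ⟨
  t ^ e * det (F ((3 , K) ∷ (0 , 1ℤ) ∷ (1 , W) ∷ (2 , W) ∷ []))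
    ≡⟨ cong (t ^ e *_) (det-merge runSign t -1ℤ 3 0 K 1ℤ ((1 , W) ∷ (2 , W) ∷ []) switching-twins) ⟩
  t ^ e * (t * det (F ((0 , K + 1ℤ) ∷ (1 , W) ∷ (2 , W) ∷ [])))
    ≡⟨ cong (λ d → t ^ e * (t * d)) (det-quotient t W (K + 1ℤ)) ⟩
  t ^ e * (t * seidelCubic W (K + 1ℤ) t)
    ≡⟨ cong₂ (λ j K′ → t ^ j * (t * seidelCubic W K′ t)) exponent merged-weight ⟩
  t ^ (m ℕ.+ m ℕ.+ k) * (t * seidelCubic W (+ suc (suc k)) t)
    ∎
  where
  open ≡-Reasoning
  t W K : ℤ
  t = x + 1ℤ
  W = + suc m
  K = + suc k
  sizes : List ℕ
  sizes = map suc (0 ∷ m ∷ m ∷ k ∷ [])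
  e : ℕ
  e = sum (0 ∷ m ∷ m ∷ k ∷ [])
  F : (xs : List (ℕ × ℤ)) → Mat (length xs)
  F = classMatrix runSign t
  exponent : e ≡ m ℕ.+ m ℕ.+ k
  exponent = trans (cong (λ j → m ℕ.+ (m ℕ.+ j)) (ℕ.+-identityʳ k)) (sym (ℕ.+-assoc m m k))
  merged-weight : K + 1ℤ ≡ + suc (suc k)
  merged-weight = cong +_ (ℕ.+-comm (suc k) 1)
  switching-twins : All (Twins runSign -1ℤ 3 0 ∘ proj₁) ((3 , K) ∷ (0 , 1ℤ) ∷ (1 , W) ∷ (2 , W) ∷ [])
  switching-twins = (refl , refl) All.∷ (refl , refl) All.∷ (refl , refl) All.∷ (refl , refl) All.∷ All.[]

integralSpectrum : ∀ {m n} {M : Mat n} (ev : Vec ℤ m) → m ≡ n →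
                   (∀ x → charPolyAt M x ≡ prodFin (λ i → x - V.lookup ev i)) → IntegralSpectrum M
integralSpectrum ev refl factorises = ev , factorises

prodFin-replicate-++ : ∀ (x c : ℤ) e {k} (ys : Vec ℤ k) →
  prodFin (λ i → x - V.lookup (V.replicate e c V.++ ys) i) ≡ (x - c) ^ e * prodFin (λ i → x - V.lookup ys i)
prodFin-replicate-++ x c zero    ys = sym (ℤ.*-identityˡ _)
prodFin-replicate-++ x c (suc e) ys =
  trans (cong ((x - c) *_) (prodFin-replicate-++ x c e ys)) (sym (ℤ.*-assoc (x - c) ((x - c) ^ e) _))

private
  vieta : ∀ y P Q S → (y + P) * (y - Q) * (y - S)
                      ≡ y * y * y - (Q + S - P) * (y * y) + (Q * S - P * (Q + S)) * y + P * Q * S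
  vieta = solve-∀
  cancel-left : ∀ P N → P + N - P ≡ N
  cancel-left = solve-∀
  drop-linear-term : ∀ y A C → A + 0ℤ * y + C ≡ A + C
  drop-linear-term = solve-∀

seidelCubic-roots : ∀ {W K P Q S : ℤ} →
                    Q + S ≡ P + (W + W + K) → Q * S ≡ P * (Q + S) → P * Q * S ≡ + 4 * K * (W * W) →
                    ∀ y → seidelCubic W K y ≡ (y + P) * (y - Q) * (y - S)
seidelCubic-roots {W} {K} {P} {Q} {S} sum≡ pair≡ prod≡ y = sym (begin
  (y + P) * (y - Q) * (y - S)
    ≡⟨ vieta y P Q S ⟩
  y * y * y - (Q + S - P) * (y * y) + (Q * S - P * (Q + S)) * y + P * Q * S
    ≡⟨ cong₂ (λ N B → y * y * y - N * (y * y) + B * y + P * Q * S) coefficient₂ coefficient₁ ⟩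
  y * y * y - (W + W + K) * (y * y) + 0ℤ * y + P * Q * S
    ≡⟨ drop-linear-term y (y * y * y - (W + W + K) * (y * y)) (P * Q * S) ⟩
  y * y * y - (W + W + K) * (y * y) + P * Q * S
    ≡⟨ cong (λ C → y * y * y - (W + W + K) * (y * y) + C) prod≡ ⟩
  seidelCubic W K y
    ∎)
  where
  open ≡-Reasoning
  coefficient₂ : Q + S - P ≡ W + W + K
  coefficient₂ = trans (cong (_- P) sum≡) (cancel-left P (W + W + K))
  coefficient₁ : Q * S - P * (Q + S) ≡ 0ℤ
  coefficient₁ = trans (cong (_- P * (Q + S)) pair≡) (ℤ.+-inverseʳ (P * (Q + S)))

private
  linear-factors : ∀ x P Q S →
    (x + 1ℤ) * ((x + 1ℤ + P) * (x + 1ℤ - Q) * (x + 1ℤ - S))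
      ≡ (x - -1ℤ) * ((x - (- P - 1ℤ)) * ((x - (Q - 1ℤ)) * ((x - (S - 1ℤ)) * 1ℤ)))
  linear-factors = solve-∀
  length-0-1ᵐ-0ᵐ-1ᵏ : ∀ m k → suc (suc m ℕ.+ (suc m ℕ.+ (suc k ℕ.+ 0))) ≡ m ℕ.+ m ℕ.+ k ℕ.+ 4
  length-0-1ᵐ-0ᵐ-1ᵏ = ℕ-Solver.solve-∀

-- The hypotheses on p, q, s are Vieta's formulas for the roots −p, q, s of seidelCubic m K.
seidelIntegral-of-cubicRoots :
  ∀ {n m K} (p q s : ℕ) → 1 ≤ m → 2 ≤ K → n ≡ m ℕ.+ m ℕ.+ K →
  q ℕ.+ s ≡ p ℕ.+ (m ℕ.+ m ℕ.+ K) → q ℕ.* s ≡ p ℕ.* (q ℕ.+ s) → p ℕ.* q ℕ.* s ≡ 4 ℕ.* K ℕ.* (m ℕ.* m) →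
  SeidelIntegral (str n m)
seidelIntegral-of-cubicRoots {m = suc m} {K = suc (suc k)} p q s (s≤s z≤n) (s≤s (s≤s z≤n)) refl sum≡ pair≡ prod≡ =
  integralSpectrum {M = seidel (str (suc m ℕ.+ suc m ℕ.+ suc (suc k)) (suc m))} eigenvalues length≡
    (λ x → trans (seidel-charPoly-str m k x) (factorise x))
  where
  open ≡-Reasoning
  P Q S W K : ℤ
  P = + p
  Q = + q
  S = + s
  W = + suc m
  K = + suc (suc k)
  e : ℕ
  e = m ℕ.+ m ℕ.+ k
  pair≡ℤ : Q * S ≡ P * (Q + S)
  pair≡ℤ = trans (sym (ℤ.pos-* q s)) (trans (cong +_ pair≡) (ℤ.pos-* p (q ℕ.+ s)))
  prod≡ℤ : P * Q * S ≡ + 4 * K * (W * W)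
  prod≡ℤ = begin
    P * Q * S                                    ≡⟨ cong (_* S) (ℤ.pos-* p q) ⟨
    + (p ℕ.* q) * S                              ≡⟨ ℤ.pos-* (p ℕ.* q) s ⟨
    + (p ℕ.* q ℕ.* s)                            ≡⟨ cong +_ prod≡ ⟩
    + (4 ℕ.* suc (suc k) ℕ.* (suc m ℕ.* suc m))  ≡⟨ ℤ.pos-* (4 ℕ.* suc (suc k)) (suc m ℕ.* suc m) ⟩
    + (4 ℕ.* suc (suc k)) * + (suc m ℕ.* suc m)  ≡⟨ cong₂ _*_ (ℤ.pos-* 4 (suc (suc k))) (ℤ.pos-* (suc m) (suc m)) ⟩
    + 4 * K * (W * W)                            ∎
  roots : ∀ y → seidelCubic W K y ≡ (y + P) * (y - Q) * (y - S)
  roots = seidelCubic-roots {W} {K} {P} {Q} {S} (cong +_ sum≡) pair≡ℤ prod≡ℤ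
  eigenvalues : Vec ℤ (e ℕ.+ 4)
  eigenvalues = V.replicate e -1ℤ V.++ (-1ℤ V.∷ (- P - 1ℤ) V.∷ (Q - 1ℤ) V.∷ (S - 1ℤ) V.∷ V.[])
  length≡ : e ℕ.+ 4 ≡ length (str (suc m ℕ.+ suc m ℕ.+ suc (suc k)) (suc m))
  length≡ = sym (begin
    length (str (suc m ℕ.+ suc m ℕ.+ suc (suc k)) (suc m))  ≡⟨ cong length (str-runs (suc m) (suc k)) ⟩
    length (runs runBit (map suc (0 ∷ m ∷ m ∷ k ∷ [])))    ≡⟨ length-runs runBit (map suc (0 ∷ m ∷ m ∷ k ∷ [])) ⟩
    sum (map suc (0 ∷ m ∷ m ∷ k ∷ []))                     ≡⟨ length-0-1ᵐ-0ᵐ-1ᵏ m k ⟩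
    e ℕ.+ 4                                                ∎)
  factorise : ∀ x → (x + 1ℤ) ^ e * ((x + 1ℤ) * seidelCubic W K (x + 1ℤ)) ≡ prodFin (λ i → x - V.lookup eigenvalues i)
  factorise x = begin
    (x + 1ℤ) ^ e * ((x + 1ℤ) * seidelCubic W K (x + 1ℤ))
      ≡⟨ cong (λ c → (x + 1ℤ) ^ e * ((x + 1ℤ) * c)) (roots (x + 1ℤ)) ⟩
    (x + 1ℤ) ^ e * ((x + 1ℤ) * ((x + 1ℤ + P) * (x + 1ℤ - Q) * (x + 1ℤ - S)))
      ≡⟨ cong ((x + 1ℤ) ^ e *_) (linear-factors x P Q S) ⟩
    (x - -1ℤ) ^ e * ((x - -1ℤ) * ((x - (- P - 1ℤ)) * ((x - (Q - 1ℤ)) * ((x - (S - 1ℤ)) * 1ℤ))))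
      ≡⟨ prodFin-replicate-++ x -1ℤ e (-1ℤ V.∷ (- P - 1ℤ) V.∷ (Q - 1ℤ) V.∷ (S - 1ℤ) V.∷ V.[]) ⟨
    prodFin (λ i → x - V.lookup eigenvalues i)
      ∎

seidelIntegral-fam1 : ∀ r → 2 ≤ r → SeidelIntegral (str (3 ℕ.* r) r)
seidelIntegral-fam1 r r≥2 =
  seidelIntegral-of-cubicRoots {3 ℕ.* r} {r} {r} r (2 ℕ.* r) (2 ℕ.* r)
    (ℕ.<⇒≤ r≥2) r≥2
    (ℕ-Solver.solve (r ∷ [])) (ℕ-Solver.solve (r ∷ [])) (ℕ-Solver.solve (r ∷ [])) (ℕ-Solver.solve (r ∷ []))

seidelIntegral-fam2a : ∀ r → 2 ≤ r → SeidelIntegral (str (13 ℕ.* r) (6 ℕ.* r))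
seidelIntegral-fam2a r r≥2 =
  seidelIntegral-of-cubicRoots {13 ℕ.* r} {6 ℕ.* r} {r} (3 ℕ.* r) (4 ℕ.* r) (12 ℕ.* r)
    (ℕ.≤-trans (ℕ.<⇒≤ r≥2) (ℕ.m≤n*m r 6)) r≥2
    (ℕ-Solver.solve (r ∷ [])) (ℕ-Solver.solve (r ∷ [])) (ℕ-Solver.solve (r ∷ [])) (ℕ-Solver.solve (r ∷ []))

seidelIntegral-fam2b : ∀ r → 2 ≤ r → SeidelIntegral (str (13 ℕ.* r) (2 ℕ.* r))
seidelIntegral-fam2b r r≥2 =
  seidelIntegral-of-cubicRoots {13 ℕ.* r} {2 ℕ.* r} {9 ℕ.* r} (3 ℕ.* r) (4 ℕ.* r) (12 ℕ.* r)
    (ℕ.≤-trans (ℕ.<⇒≤ r≥2) (ℕ.m≤n*m r 2)) (ℕ.≤-trans r≥2 (ℕ.m≤n*m r 9))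
    (ℕ-Solver.solve (r ∷ [])) (ℕ-Solver.solve (r ∷ [])) (ℕ-Solver.solve (r ∷ [])) (ℕ-Solver.solve (r ∷ []))

seidelIntegral-fam3 : ∀ r → 1 ≤ r → SeidelIntegral (str (2 ℕ.* r ℕ.* r ℕ.+ 2 ℕ.* r ℕ.+ 2) (r ℕ.* r ℕ.+ r))
seidelIntegral-fam3 r r≥1 =
  seidelIntegral-of-cubicRoots {2 ℕ.* r ℕ.* r ℕ.+ 2 ℕ.* r ℕ.+ 2} {r ℕ.* r ℕ.+ r} {2}
    (2 ℕ.* r) (2 ℕ.* r ℕ.+ 2) (2 ℕ.* r ℕ.* r ℕ.+ 2 ℕ.* r)
    (ℕ.≤-trans r≥1 (ℕ.m≤n+m r (r ℕ.* r))) ℕ.≤-refl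
    (ℕ-Solver.solve (r ∷ [])) (ℕ-Solver.solve (r ∷ [])) (ℕ-Solver.solve (r ∷ [])) (ℕ-Solver.solve (r ∷ []))

seidelIntegral-fam4 : ∀ r → 3 ≤ r → SeidelIntegral (str (4 ℕ.* r ℕ.* r ∸ 2 ℕ.* r ℕ.+ 1) r)
seidelIntegral-fam4 (suc r) (s≤s r≥2) =
  seidelIntegral-of-cubicRoots {4 ℕ.* suc r ℕ.* suc r ∸ 2 ℕ.* suc r ℕ.+ 1} {suc r} {suc (2 ℕ.* r) ℕ.* suc (2 ℕ.* r)}
    (suc (2 ℕ.* r)) (2 ℕ.* suc r) (2 ℕ.* suc r ℕ.* suc (2 ℕ.* r))
    (s≤s z≤n) K≥2 shape (ℕ-Solver.solve (r ∷ [])) (ℕ-Solver.solve (r ∷ [])) (ℕ-Solver.solve (r ∷ []))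
  where
  open ≡-Reasoning
  K≥2 : 2 ≤ suc (2 ℕ.* r) ℕ.* suc (2 ℕ.* r)
  K≥2 = ℕ.≤-trans (s≤s (ℕ.≤-trans (ℕ.<⇒≤ r≥2) (ℕ.m≤n*m r 2))) (ℕ.m≤m*n (suc (2 ℕ.* r)) (suc (2 ℕ.* r)))
  square : 4 ℕ.* suc r ℕ.* suc r ≡ 2 ℕ.* suc r ℕ.* suc (2 ℕ.* r) ℕ.+ 2 ℕ.* suc r
  square = ℕ-Solver.solve (r ∷ [])
  shape : 4 ℕ.* suc r ℕ.* suc r ∸ 2 ℕ.* suc r ℕ.+ 1 ≡ suc r ℕ.+ suc r ℕ.+ suc (2 ℕ.* r) ℕ.* suc (2 ℕ.* r)
  shape = begin
    4 ℕ.* suc r ℕ.* suc r ∸ 2 ℕ.* suc r ℕ.+ 1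
      ≡⟨ cong (λ a → a ∸ 2 ℕ.* suc r ℕ.+ 1) square ⟩
    2 ℕ.* suc r ℕ.* suc (2 ℕ.* r) ℕ.+ 2 ℕ.* suc r ∸ 2 ℕ.* suc r ℕ.+ 1
      ≡⟨ cong (ℕ._+ 1) (ℕ.m+n∸n≡m (2 ℕ.* suc r ℕ.* suc (2 ℕ.* r)) (2 ℕ.* suc r)) ⟩
    2 ℕ.* suc r ℕ.* suc (2 ℕ.* r) ℕ.+ 1
      ≡⟨ ℕ-Solver.solve (r ∷ []) ⟩
    suc r ℕ.+ suc r ℕ.+ suc (2 ℕ.* r) ℕ.* suc (2 ℕ.* r)
      ∎

seidelIntegral-fam5 : ∀ r → 1 ≤ r → SeidelIntegral (str (4 ℕ.* r ℕ.* r ℕ.+ 4 ℕ.* r ℕ.+ 4) (2 ℕ.* r ℕ.* r ℕ.+ 2 ℕ.* r))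
seidelIntegral-fam5 r r≥1 =
  seidelIntegral-of-cubicRoots {4 ℕ.* r ℕ.* r ℕ.+ 4 ℕ.* r ℕ.+ 4} {2 ℕ.* r ℕ.* r ℕ.+ 2 ℕ.* r} {4}
    (4 ℕ.* r) (4 ℕ.* r ℕ.+ 4) (4 ℕ.* r ℕ.* r ℕ.+ 4 ℕ.* r)
    (ℕ.≤-trans r≥1 (ℕ.≤-trans (ℕ.m≤n*m r 2) (ℕ.m≤n+m (2 ℕ.* r) (2 ℕ.* r ℕ.* r)))) (s≤s (s≤s z≤n))
    (ℕ-Solver.solve (r ∷ [])) (ℕ-Solver.solve (r ∷ [])) (ℕ-Solver.solve (r ∷ [])) (ℕ-Solver.solve (r ∷ []))

mainTheorem6 : ∀ (n m : ℕ) → 1 ≤ n → 1 ≤ m → Family n m → SeidelIntegral (str n m)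
mainTheorem6 _ _ _ _ (fam1  r r≥2) = seidelIntegral-fam1  r r≥2
mainTheorem6 _ _ _ _ (fam2a r r≥2) = seidelIntegral-fam2a r r≥2
mainTheorem6 _ _ _ _ (fam2b r r≥2) = seidelIntegral-fam2b r r≥2
mainTheorem6 _ _ _ _ (fam3  r r≥1) = seidelIntegral-fam3  r r≥1
mainTheorem6 _ _ _ _ (fam4  r r≥3) = seidelIntegral-fam4  r r≥3
mainTheorem6 _ _ _ _ (fam5  r r≥1) = seidelIntegral-fam5  r r≥1
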